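{- Let $\mathscr{I}=(F,C,d,m,\mathscr{F})$ be a Robust $\mathscr{F}$-Supplier instance, $\mathsf{cov}:C\to\mathbb{R}_{\ge0}$, and let $(F,\mathscr{F},\mathscr{P},\mathsf{val})$, $\mathsf{Reps}$ and $\mathsf{Chld}(\cdot)$ be as produced by Algorithm 1 on input $\mathscr{I}$ and $\mathsf{cov}$. For $S\subseteq F$ let $R(S)=\{v\in\mathsf{Reps}:B_F(v,1)\cap S\ne\emptyset\}$. Then for every $S\in\mathscr{F}$ with $|S\cap A|\le1$ for all $A\in\mathscr{P}$, we have $\sum_{f\in S}\mathsf{val}(f)=\sum_{v\in R(S)}|\mathsf{Chld}(v)|$.
   Context: $X=F\cup C$ is finite with a metric $d$; $\mathscr{F}\subseteq2^F$ is down-closed; $m\in\{0,\dots,|C|\}$. For $u\in X$, $B_F(u,r)=\{f\in F:d(u,f)\le r\}$. Algorithm 1 (input $\mathscr{I}$ and $\mathsf{cov}$): set $U\leftarrow C$, $\mathsf{Reps}\leftarrow\emptyset$, $\mathscr{P}\leftarrow\emptyset$. While $U\ne\emptyset$: choose $v\in U$ maximizing $\mathsf{cov}(v)$ (ties arbitrary); add $v$ to $\mathsf{Reps}$; add the set $B_F(v,1)$ as a part of $\mathscr{P}$; let $\mathsf{Chld}(v)=\{u\in U:d(u,v)\le2\}$; set $\mathsf{val}(f)=|\mathsf{Chld}(v)|$ for all $f\in B_F(v,1)$; set $U\leftarrow U\setminus\mathsf{Chld}(v)$. Facilities not in any part get $\mathsf{val}(f)=0$.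
   Formalization: The metric d and the function cov take values in ℚ rather than ℝ. -}

module Defs where

open import Data.Nat using (ℕ; zero; suc; _+_)
import Data.Nat as ℕ
open import Data.Bool using (Bool; true; false; if_then_else_; _∧_)
open import Data.Fin using (Fin)
open import Data.Fin.Subset using (Subset; _∈_; _⊆_; _∩_; _∪_; _─_; ∣_∣; Empty; Nonempty; ⊤)
open import Data.Fin.Subset.Properties using (_∈?_; nonempty?)
open import Relation.Nullary using (yes; no)
open import Data.Vec using (tabulate; lookup)
open import Data.List using (List; []; _∷_; map; allFin)
open import Data.Nat.ListAction using (sum)
open import Data.Product using (_×_; _,_; proj₁; proj₂)
open import Data.Rational using (ℚ; 0ℚ; 1ℚ; _≤_)
import Data.Rational as ℚ
open import Data.Rational.Properties using (_≤?_)
open import Relation.Nullary using (does)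
open import Relation.Binary.PropositionalEquality using (_≡_)

record IsMetric {n : ℕ} (d : Fin n → Fin n → ℚ) : Set where
  field
    nonneg   : ∀ x y → 0ℚ ≤ d x y
    zero-iff : ∀ x y → d x y ≡ 0ℚ → x ≡ y
    refl0    : ∀ x → d x x ≡ 0ℚ
    symm     : ∀ x y → d x y ≡ d y x
    triangle : ∀ x y z → d x z ≤ d x y ℚ.+ d y z

record Instance (n : ℕ) : Set₁ where
  field
    F C     : Subset n
    covers  : F ∪ C ≡ ⊤
    d       : Fin n → Fin n → ℚ
    metric  : IsMetric d
    m       : ℕ
    m≤|C|   : m ℕ.≤ ∣ C ∣
    𝓕       : Subset n → Set
    𝓕⊆2^F   : ∀ S → 𝓕 S → S ⊆ F
    downClosed : ∀ S T → 𝓕 S → T ⊆ S → 𝓕 T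

restrict : {n : ℕ} → Subset n → (Fin n → ℚ) → ℚ → Subset n
restrict U δ r = tabulate (λ u → lookup U u ∧ does (δ u ≤? r))

two : ℚ
two = 1ℚ ℚ.+ 1ℚ

module Alg {n : ℕ} (I : Instance n) (cov : Fin n → ℚ) where
  open Instance I

  B_F : Fin n → ℚ → Subset n
  B_F u r = restrict F (λ f → d u f) r

  chld : Subset n → Fin n → Subset n
  chld U v = restrict U (λ u → d u v) two

  -- Valid executions of the while loop starting from the current U.  The
  -- output list records, in order of selection, each representative v
  -- together with Chld(v).  Ties in the choice of v are arbitrary: any
  -- maximiser of cov in U may be chosen.
  data Run (U : Subset n) : List (Fin n × Subset n) → Set where
    done : Empty U → Run U []
    step : ∀ {rest} (v : Fin n) → v ∈ U
         → (∀ u → u ∈ U → cov u ≤ cov v)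
         → Run (U ─ chld U v) rest
         → Run U ((v , chld U v) ∷ rest)

  Algorithm1 : List (Fin n × Subset n) → Set
  Algorithm1 out = Run C out

  parts : List (Fin n × Subset n) → List (Subset n)
  parts out = map (λ p → B_F (proj₁ p) 1ℚ) out

  -- val, following the assignments of the algorithm in order ("set
  -- val(f) = |Chld(v)| for f ∈ B_F(v,1)"); untouched facilities get 0.
  valFrom : (Fin n → ℕ) → List (Fin n × Subset n) → Fin n → ℕ
  valFrom acc [] = acc
  valFrom acc ((v , ch) ∷ rest) =
    valFrom (λ f → if does (f ∈? B_F v 1ℚ) then ∣ ch ∣ else acc f) rest

  val : List (Fin n × Subset n) → Fin n → ℕ
  val out = valFrom (λ _ → 0) out

  sumOver : Subset n → (Fin n → ℕ) → ℕ
  sumOver S g = sum (map (λ f → if does (f ∈? S) then g f else 0) (allFin n))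

  -- Representatives are pairwise distinct (each is removed from U when
  -- chosen), so summing over the output list sums over the set R(S).
  sumR : Subset n → List (Fin n × Subset n) → ℕ
  sumR S [] = 0
  sumR S ((v , ch) ∷ rest) with nonempty? (B_F v 1ℚ ∩ S)
  ... | yes _ = ∣ ch ∣ + sumR S rest
  ... | no _  = sumR S rest

-- A facility f ∈ B_F(v,1) lies in no ball B_F(w,1) of a later representative w:
-- otherwise d(w,v) ≤ d(w,f) + d(f,v) ≤ 2, so w would have been removed from U as
-- a child of v.  Hence val(f) is set at most once, val = Σ_v [f ∈ B_F(v,1)]·|Chld(v)|,
-- and Σ_{f∈S} val(f) = Σ_v |S ∩ B_F(v,1)|·|Chld(v)|, where |S ∩ B_F(v,1)| ≤ 1 is
-- 1 precisely when v ∈ R(S).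
module Submission where

open import Defs
import Data.Nat.Properties as ℕ
open import Algebra.Properties.CommutativeSemigroup ℕ.+-commutativeSemigroup using (interchange)
open import Data.Bool using (true; false; if_then_else_; _∧_)
open import Data.Bool.Properties using (∧-conicalʳ)
open import Data.Fin using (Fin; zero; suc)
import Data.Fin.Subset
open import Data.Fin.Subset using (Subset; _∈_; _∉_; _∩_; _─_; ∣_∣; Empty; Nonempty; inside; outside)
open import Data.Fin.Subset.Properties
  using (_∈?_; nonempty?; x∈p∩q⁺; x∈p∩q⁻; ∩-comm; p─q⊆p; p⊆q⇒∣p∣≤∣q∣; ∣⁅x⁆∣≡1; x∈⁅y⁆⇒x≡y; Empty-unique; ∣⊥∣≡0)
open import Data.List using (List; []; _∷_; map; allFin)
import Data.List.Membership.Propositional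
open import Data.List.Membership.Propositional using () renaming (_∈_ to _∈ₗ_)
open import Data.List.Properties using (map-cong; map-tabulate)
open import Data.List.Relation.Unary.All as All using (All; []; _∷_)
open import Data.List.Relation.Unary.Any using (here; there)
open import Data.Nat using (ℕ; _+_; _*_; _≤_)
open import Data.Nat.ListAction using (sum)
open import Data.Product using (_×_; _,_; proj₁; proj₂)
open import Data.Rational using (ℚ; 0ℚ; 1ℚ)
import Data.Rational as Q
import Data.Rational.Properties as Q
open import Data.Vec using (lookup; []; _∷_; here; there)
open import Data.Vec.Properties using ([]=⇒lookup; lookup⇒[]=; lookup∘tabulate)
open import Function using (_∘_; const)
open import Relation.Binary.PropositionalEquality using (_≡_; refl; sym; trans; cong; cong₂; subst; module ≡-Reasoning)
open import Relation.Nullary using (yes; no; does; proof; Reflects; invert)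
open import Relation.Nullary.Decidable using (dec-true; dec-false)

private
  variable
    n : ℕ
    p q : Subset n
    x : Fin n

∑ : (Fin n → ℕ) → ℕ
∑ {n} g = sum (map g (allFin n))

-- mask p g is 𝟙_p · g, so Alg.sumOver S g unfolds to ∑ (mask S g).
mask : Subset n → (Fin n → ℕ) → Fin n → ℕ
mask p g x = if does (x ∈? p) then g x else 0

∑-cong : {g h : Fin n → ℕ} → (∀ x → g x ≡ h x) → ∑ g ≡ ∑ h
∑-cong {n} e = cong sum (map-cong e (allFin n))

∑-+ : (g h : Fin n → ℕ) → ∑ (λ x → g x + h x) ≡ ∑ g + ∑ h
∑-+ {n} g h = sum-map-+ (allFin n)
  where
  sum-map-+ : ∀ xs → sum (map (λ x → g x + h x) xs) ≡ sum (map g xs) + sum (map h xs)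
  sum-map-+ []       = refl
  sum-map-+ (x ∷ xs) = trans (cong (g x + h x +_) (sum-map-+ xs)) (interchange (g x) (h x) _ _)

∑-suc : (g : Fin (ℕ.suc n) → ℕ) → ∑ g ≡ g zero + ∑ (g ∘ suc)
∑-suc {n} g = cong (λ xs → g zero + sum xs)
  (trans (map-tabulate suc g) (sym (map-tabulate (λ x → x) (g ∘ suc))))

∑-mask-const : (p : Subset n) (c : ℕ) → ∑ (mask p (const c)) ≡ ∣ p ∣ * c
∑-mask-const []            c = refl
∑-mask-const (inside ∷ p)  c = trans (∑-suc (mask (inside ∷ p) (const c))) (cong (c +_) (∑-mask-const p c))
∑-mask-const (outside ∷ p) c = trans (∑-suc (mask (outside ∷ p) (const c))) (∑-mask-const p c)

mask-+ : (p : Subset n) (g h : Fin n → ℕ) (x : Fin n) → mask p (λ y → g y + h y) x ≡ mask p g x + mask p h x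
mask-+ p g h x with does (x ∈? p)
... | true  = refl
... | false = refl

mask-∩ : (p q : Subset n) (g : Fin n → ℕ) (x : Fin n) → mask p (mask q g) x ≡ mask (p ∩ q) g x
mask-∩ p q g x with x ∈? p | x ∈? q
... | yes x∈p | yes x∈q = cong (if_then g x else 0) (sym (dec-true (x ∈? p ∩ q) (x∈p∩q⁺ (x∈p , x∈q))))
... | yes _   | no x∉q  = cong (if_then g x else 0) (sym (dec-false (x ∈? p ∩ q) (x∉q ∘ proj₂ ∘ x∈p∩q⁻ p q)))
... | no x∉p  | _       = cong (if_then g x else 0) (sym (dec-false (x ∈? p ∩ q) (x∉p ∘ proj₁ ∘ x∈p∩q⁻ p q)))

∑-mask-cong : (p : Subset n) {g h : Fin n → ℕ} → (∀ x → g x ≡ h x) → ∑ (mask p g) ≡ ∑ (mask p h)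
∑-mask-cong p e = ∑-cong (λ x → cong (if does (x ∈? p) then_else 0) (e x))

∑-mask-+ : (p : Subset n) (g h : Fin n → ℕ) → ∑ (mask p (λ x → g x + h x)) ≡ ∑ (mask p g) + ∑ (mask p h)
∑-mask-+ p g h = trans (∑-cong (mask-+ p g h)) (∑-+ (mask p g) (mask p h))

∑-mask-indicator : (p q : Subset n) (c : ℕ) → ∑ (mask p (mask q (const c))) ≡ ∣ p ∩ q ∣ * c
∑-mask-indicator p q c = trans (∑-cong (mask-∩ p q (const c))) (∑-mask-const (p ∩ q) c)

x∈p─q⇒x∉q : (p q : Subset n) → x ∈ p ─ q → x ∉ q
x∈p─q⇒x∉q (_ ∷ p) (inside ∷ q) ()             here
x∈p─q⇒x∉q (_ ∷ p) (_ ∷ q)      (there x∈p─q) (there x∈q) = x∈p─q⇒x∉q p q x∈p─q x∈q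

Nonempty⇒1≤∣p∣ : Nonempty p → 1 ≤ ∣ p ∣
Nonempty⇒1≤∣p∣ {p = p} (x , x∈p) = subst (_≤ ∣ p ∣) (∣⁅x⁆∣≡1 x)
  (p⊆q⇒∣p∣≤∣q∣ (λ y∈⁅x⁆ → subst (_∈ p) (sym (x∈⁅y⁆⇒x≡y x y∈⁅x⁆)) x∈p))

Empty⇒∣p∣≡0 : Empty p → ∣ p ∣ ≡ 0
Empty⇒∣p∣≡0 {n} e = trans (cong ∣_∣ (Empty-unique e)) (∣⊥∣≡0 n)

module _ {U : Subset n} {δ : Fin n → ℚ} {r : ℚ} where

  lookup-restrict : (x : Fin n) → lookup (restrict U δ r) x ≡ (lookup U x ∧ does (δ x Q.≤? r))
  lookup-restrict = lookup∘tabulate (λ u → lookup U u ∧ does (δ u Q.≤? r))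

  ∈-restrict⁺ : x ∈ U → δ x Q.≤ r → x ∈ restrict U δ r
  ∈-restrict⁺ {x} x∈U δx≤r = lookup⇒[]= x (restrict U δ r) (begin
    lookup (restrict U δ r) x            ≡⟨ lookup-restrict x ⟩
    lookup U x ∧ does (δ x Q.≤? r)      ≡⟨ cong₂ _∧_ ([]=⇒lookup x∈U) (dec-true (δ x Q.≤? r) δx≤r) ⟩
    true                                 ∎)
    where open ≡-Reasoning

  ∈-restrict⁻ : x ∈ restrict U δ r → δ x Q.≤ r
  ∈-restrict⁻ {x} x∈ = invert (subst (Reflects (δ x Q.≤ r))
    (∧-conicalʳ (lookup U x) _ (trans (sym (lookup-restrict x)) ([]=⇒lookup x∈)))
    (proof (δ x Q.≤? r)))

module Algorithm1Properties (I : Instance n) (cov : Fin n → ℚ) where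
  open Instance I
  open Alg I cov
  open IsMetric metric

  OutsideBalls : Fin n → List (Fin n × Subset n) → Set
  OutsideBalls f = All (λ (w , _) → f ∉ B_F w 1ℚ)

  ∈B_F⁻ : ∀ {f u r} → f ∈ B_F u r → d u f Q.≤ r
  ∈B_F⁻ {u = u} {r} = ∈-restrict⁻ {U = F} {d u} {r}

  ∈chld⁺ : ∀ {U w v} → w ∈ U → d w v Q.≤ two → w ∈ chld U v
  ∈chld⁺ {U} {v = v} = ∈-restrict⁺ {U = U} {λ u → d u v} {two}

  balls-meet⇒dist≤ : ∀ {f w v r s} → f ∈ B_F w r → f ∈ B_F v s → d w v Q.≤ r Q.+ s
  balls-meet⇒dist≤ {f} {w} {v} {r} {s} f∈Bw f∈Bv = Q.≤-trans (triangle w f v)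
    (Q.+-mono-≤ (∈B_F⁻ {r = r} f∈Bw) (subst (Q._≤ s) (symm v f) (∈B_F⁻ {r = s} f∈Bv)))

  reps⊆ : ∀ {U out} → Run U out → All (λ (w , _) → w ∈ U) out
  reps⊆     (done _)             = []
  reps⊆ {U} (step v v∈U _ run) = v∈U ∷ All.map (p─q⊆p U (chld U v)) (reps⊆ run)

  outside-later-balls : ∀ {U v ch rest f} → Run U ((v , ch) ∷ rest) → f ∈ B_F v 1ℚ → OutsideBalls f rest
  outside-later-balls {U} {f = f} (step v _ _ run) f∈Bv = All.map later-far (reps⊆ run)
    where
    later-far : ∀ {w} → w ∈ U ─ chld U v → f ∉ B_F w 1ℚ
    later-far {w} w∈U─chld f∈Bw = x∈p─q⇒x∉q U (chld U v) w∈U─chld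
      (∈chld⁺ (p─q⊆p U (chld U v) w∈U─chld) (balls-meet⇒dist≤ {r = 1ℚ} {1ℚ} f∈Bw f∈Bv))

  valFrom-outside : ∀ {f} acc out → OutsideBalls f out → valFrom acc out f ≡ acc f
  valFrom-outside acc []                [] = refl
  valFrom-outside {f} acc ((w , ch) ∷ rest) (f∉Bw ∷ f∉rest) =
    trans (valFrom-outside _ rest f∉rest) (cong (if_then ∣ ch ∣ else acc f) (dec-false (f ∈? B_F w 1ℚ) f∉Bw))

  valFrom-local : ∀ {f acc acc′} out → acc f ≡ acc′ f → valFrom acc out f ≡ valFrom acc′ out f
  valFrom-local []                e = e
  valFrom-local {f} ((w , ch) ∷ rest) e =
    valFrom-local rest (cong (if does (f ∈? B_F w 1ℚ) then ∣ ch ∣ else_) e)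

  val-∷ : ∀ {U v ch rest} → Run U ((v , ch) ∷ rest) →
          ∀ f → val ((v , ch) ∷ rest) f ≡ mask (B_F v 1ℚ) (const ∣ ch ∣) f + val rest f
  val-∷ {v = v} {ch} {rest} run f with f ∈? B_F v 1ℚ
  ... | yes f∈Bv = begin
    valFrom _ rest f                 ≡⟨ valFrom-outside _ rest f∉later ⟩
    mask (B_F v 1ℚ) (const ∣ ch ∣) f ≡⟨ cong (if_then ∣ ch ∣ else 0) (dec-true (f ∈? B_F v 1ℚ) f∈Bv) ⟩
    ∣ ch ∣                           ≡⟨ ℕ.+-identityʳ ∣ ch ∣ ⟨
    ∣ ch ∣ + 0                       ≡⟨ cong (∣ ch ∣ +_) (valFrom-outside _ rest f∉later) ⟨
    ∣ ch ∣ + val rest f              ∎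
    where
    open ≡-Reasoning
    f∉later : OutsideBalls f rest
    f∉later = outside-later-balls run f∈Bv
  ... | no f∉Bv = valFrom-local rest (cong (if_then ∣ ch ∣ else 0) (dec-false (f ∈? B_F v 1ℚ) f∉Bv))

  module _ (S : Subset n) where

    sumOver-val-∷ : ∀ {U v ch rest} → Run U ((v , ch) ∷ rest) →
                    sumOver S (val ((v , ch) ∷ rest)) ≡ ∣ S ∩ B_F v 1ℚ ∣ * ∣ ch ∣ + sumOver S (val rest)
    sumOver-val-∷ {v = v} {ch} {rest} run = begin
      sumOver S (val ((v , ch) ∷ rest))
        ≡⟨ ∑-mask-cong S (val-∷ run) ⟩
      ∑ (mask S (λ f → mask (B_F v 1ℚ) (const ∣ ch ∣) f + val rest f))
        ≡⟨ ∑-mask-+ S _ (val rest) ⟩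
      ∑ (mask S (mask (B_F v 1ℚ) (const ∣ ch ∣))) + sumOver S (val rest)
        ≡⟨ cong (_+ sumOver S (val rest)) (∑-mask-indicator S (B_F v 1ℚ) ∣ ch ∣) ⟩
      ∣ S ∩ B_F v 1ℚ ∣ * ∣ ch ∣ + sumOver S (val rest)
        ∎
      where open ≡-Reasoning

    sumR-∷ : ∀ {v ch} rest → ∣ S ∩ B_F v 1ℚ ∣ ≤ 1 →
             sumR S ((v , ch) ∷ rest) ≡ ∣ S ∩ B_F v 1ℚ ∣ * ∣ ch ∣ + sumR S rest
    sumR-∷ {v} {ch} rest ∣S∩Bv∣≤1 with nonempty? (B_F v 1ℚ ∩ S)
    ... | yes Bv∩S≠∅ = cong (_+ sumR S rest) (sym (trans
          (cong (_* ∣ ch ∣) (ℕ.≤-antisym ∣S∩Bv∣≤1 (Nonempty⇒1≤∣p∣ (subst Nonempty (∩-comm (B_F v 1ℚ) S) Bv∩S≠∅))))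
          (ℕ.*-identityˡ ∣ ch ∣)))
    ... | no Bv∩S=∅ = cong (λ k → k * ∣ ch ∣ + sumR S rest)
          (sym (Empty⇒∣p∣≡0 (Bv∩S=∅ ∘ subst Nonempty (∩-comm S (B_F v 1ℚ)))))

    sumOver-val≡sumR : ∀ {U out} → Run U out → (∀ A → A ∈ₗ parts out → ∣ S ∩ A ∣ ≤ 1) →
                       sumOver S (val out) ≡ sumR S out
    sumOver-val≡sumR (done _) _ = trans (∑-mask-const S 0) (ℕ.*-zeroʳ ∣ S ∣)
    sumOver-val≡sumR {out = (v , ch) ∷ rest} run@(step _ _ _ run′) meets-once = begin
      sumOver S (val ((v , ch) ∷ rest))                ≡⟨ sumOver-val-∷ run ⟩
      ∣ S ∩ B_F v 1ℚ ∣ * ∣ ch ∣ + sumOver S (val rest) ≡⟨ cong (∣ S ∩ B_F v 1ℚ ∣ * ∣ ch ∣ +_) induction-hypothesis ⟩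
      ∣ S ∩ B_F v 1ℚ ∣ * ∣ ch ∣ + sumR S rest          ≡⟨ sumR-∷ rest (meets-once _ (here refl)) ⟨
      sumR S ((v , ch) ∷ rest)                         ∎
      where
      open ≡-Reasoning
      induction-hypothesis : sumOver S (val rest) ≡ sumR S rest
      induction-hypothesis = sumOver-val≡sumR run′ (λ A → meets-once A ∘ there)

claim3 : ∀ {n} (I : Instance n) (cov : Fin n → ℚ)
         → (∀ u → u Data.Fin.Subset.∈ Instance.C I → 0ℚ Q.≤ cov u)
         → (out : List (Fin n × Subset n))
         → Alg.Algorithm1 I cov out
         → ∀ (S : Subset n) → Instance.𝓕 I S
         → (∀ A → A Data.List.Membership.Propositional.∈ Alg.parts I cov out → ∣ S ∩ A ∣ ≤ 1)
         → Alg.sumOver I cov S (Alg.val I cov out) ≡ Alg.sumR I cov S out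
claim3 I cov _ _ run S _ = Algorithm1Properties.sumOver-val≡sumR I cov S run
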